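{- Let $F$ and $H$ be two sets of clauses built over disjoint sets of variables, and let $x$ be a variable occurring in neither. If both $F$ and $H$ are unsatisfiable, then $x$ is the root of some optimal backtracking search tree of $F +_x H = (F\vee x)\cup(H\vee\neg x)$.
   Context: A formula is a finite set of clauses; for a literal $l$ and formula $F$, $l\vee F=\{l\vee\gamma : \gamma\in F\}$ (written $F\vee l$). $F|I$ denotes $F$ simplified under the partial assignment $I$ (clauses with a true literal removed, false literals deleted); $Var(F)$ is its set of variables. A binary tree is $()$ or $(x~T_1~T_2)$; its size is its number of nodes. A backtracking search tree (BST) of $F$ is $()$ if $F$ contains the empty clause, and otherwise $(x~T_1~T_2)$ with $x\in Var(F)$ and $T_1,T_2$ BSTs of $F|\{\neg x\}$ and $F|\{x\}$. An optimal BST is one of minimum size. -}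

module Defs where

open import Data.Nat using (ℕ; _≤_; _+_; suc; _≡ᵇ_)
open import Data.Bool using (Bool; true; false; not; _∧_; if_then_else_)
open import Data.List using (List; []; _∷_; map; filterᵇ; _++_)
open import Data.Bool.ListAction using (any)
open import Data.List.Membership.Propositional using (_∈_)
open import Data.Product using (Σ; ∃; _×_; _,_)
open import Relation.Nullary using (¬_)
open import Relation.Binary.PropositionalEquality using (_≡_)
open import Data.Bool.Properties using () renaming (_≟_ to _≟ᴮ_)
open import Relation.Nullary.Decidable using (⌊_⌋)

record Literal : Set where
  constructor lit
  field
    var  : ℕ
    pos  : Bool
open Literal public

-- A clause is a (finite) disjunction of literals, a formula a finite
-- collection of clauses (lists; duplicates are harmless for everything below).
Clause : Set
Clause = List Literal

Formula : Set
Formula = List Clause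

_==ᴸ_ : Literal → Literal → Bool
lit v b ==ᴸ lit w c = (v ≡ᵇ w) ∧ ⌊ b ≟ᴮ c ⌋

neg : Literal → Literal
neg (lit v b) = lit v (not b)

-- F | {l}: simplify F under the partial assignment making l true:
-- clauses containing l are removed, occurrences of ¬l are deleted.
_∣_ : Formula → Literal → Formula
F ∣ l = map (filterᵇ (λ m → not (m ==ᴸ neg l)))
            (filterᵇ (λ γ → not (any (_==ᴸ l) γ)) F)

VarOf : ℕ → Formula → Set
VarOf v F = Σ Clause λ γ → γ ∈ F × Σ Literal λ m → m ∈ γ × var m ≡ v

_∨F_ : Literal → Formula → Formula
l ∨F F = map (l ∷_) F

_+[_]_ : Formula → ℕ → Formula → Formula
F +[ x ] H = (lit x true ∨F F) ++ (lit x false ∨F H)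

Assignment : Set
Assignment = ℕ → Bool

evalLit : Assignment → Literal → Bool
evalLit α (lit v b) = if b then α v else not (α v)

Satisfies : Assignment → Formula → Set
Satisfies α F = ∀ γ → γ ∈ F → Σ Literal λ m → m ∈ γ × evalLit α m ≡ true

Unsatisfiable : Formula → Set
Unsatisfiable F = ¬ (Σ Assignment λ α → Satisfies α F)

data Tree : Set where
  leaf : Tree
  node : ℕ → Tree → Tree → Tree

size : Tree → ℕ
size leaf = 0
size (node _ T₁ T₂) = suc (size T₁ + size T₂)

data IsBST : Formula → Tree → Set where
  leaf : ∀ {F} → [] ∈ F → IsBST F leaf
  node : ∀ {F x T₁ T₂} → ¬ ([] ∈ F) → VarOf x F →
         IsBST (F ∣ lit x false) T₁ → IsBST (F ∣ lit x true) T₂ →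
         IsBST F (node x T₁ T₂)

OptimalBST : Formula → Tree → Set
OptimalBST F T = IsBST F T × (∀ T' → IsBST F T' → size T ≤ size T')

-- Restricting F +ₓ H by ¬x or by x gives back F or H, so for optimal BSTs T_F of F and T_H of H the
-- tree (x T_F T_H) is a BST of F +ₓ H of size 1 + |T_F| + |T_H|. Conversely, every BST T of F +ₓ H
-- contains a BST A of F and a BST B of H with |A| + |B| < |T|, by induction on T: branching on a
-- variable y of F only restricts the F-part (the formula becomes F|ℓ +ₓ H), so the F-parts of the two
-- subtrees recombine under a node on y (or a leaf, once F contains the empty clause) while the H-part
-- of one subtree is kept; symmetrically for H. Optimal BSTs of F and H exist because unsatisfiable
-- formulas have some BST and "F has a BST of size ≤ k" is decidable.
module Submission where

open import Defs
open import Data.Bool using (Bool; true; false; not; T; if_then_else_)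
open import Data.Bool.ListAction using (any)
open import Data.Bool.Properties using (T-∧; not-¬)
open import Data.Empty using (⊥-elim)
open import Data.Fin using (Fin; toℕ; fromℕ<)
open import Data.Fin.Properties using (toℕ<n; toℕ-fromℕ<) renaming (any? to anyFin?)
open import Data.List using (List; []; _∷_; map; filterᵇ; _++_)
open import Data.List.Membership.Propositional using (_∈_; _∉_; find; lose)
open import Data.List.Membership.Propositional.Properties
  using (∈-map⁺; ∈-map⁻; ∈-++⁺ˡ; ∈-++⁺ʳ; ∈-++⁻; ∈-filter⁻; ∈-map∘filter⁺; ∈-map∘filter⁻)
open import Data.List.Properties
  using (filter-accept; filter-reject; filter-all; filter-++; map-++; ++-identityʳ; ≡-dec)
open import Data.List.Relation.Unary.All as All using ()
open import Data.List.Relation.Unary.Any as Any using (here; there)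
open import Data.List.Relation.Unary.Any.Properties using (any⁺; any⁻)
open import Data.Nat using (ℕ; zero; suc; _+_; _∸_; _≤_; _<_; z≤n; s≤s; s≤s⁻¹; _≟_)
open import Data.Nat.Induction using (<-rec)
open import Data.Nat.Properties
  using ( ≡ᵇ⇒≡; ≡⇒≡ᵇ; ≤-refl; ≤-trans; ≤-reflexive; <⇒≤; ≮⇒≥; n<1+n; +-comm; +-mono-≤; +-monoˡ-≤
        ; m+[n∸m]≡n; m∸n≤m; m+n≤o⇒m≤o; m+n≤o⇒n≤o; m+n≤o⇒m≤o∸n; anyUpTo?; +-commutativeSemigroup
        ; module ≤-Reasoning)
open import Algebra.Properties.CommutativeSemigroup +-commutativeSemigroup using (xy∙z≈xz∙y)
open import Data.Product using (Σ; _×_; _,_; proj₁; proj₂)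
open import Data.Sum using (_⊎_; inj₁; inj₂)
open import Function using (_∘_; _⇔_; mk⇔; Equivalence)
open import Relation.Binary.Definitions using (DecidableEquality)
open import Relation.Binary.PropositionalEquality
open import Relation.Nullary using (¬_; Dec; yes; no; contradiction)
open import Relation.Nullary.Decidable using (T?; map′; toWitness; fromWitness; _×-dec_)

T-not⇔¬T : ∀ {b} → T (not b) ⇔ (¬ T b)
T-not⇔¬T {true}  = mk⇔ (λ ()) (λ ¬⊤ → ¬⊤ _)
T-not⇔¬T {false} = mk⇔ (λ _ ()) (λ _ → _)

==ᴸ⇒≡ : ∀ {m l} → T (m ==ᴸ l) → m ≡ l
==ᴸ⇒≡ {lit v b} {lit w c} m==l with Equivalence.to T-∧ m==l
... | v≡w , b≡c = cong₂ lit (≡ᵇ⇒≡ v w v≡w) (toWitness b≡c)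

==ᴸ-refl : ∀ l → T (l ==ᴸ l)
==ᴸ-refl (lit v b) = Equivalence.from T-∧ (≡⇒≡ᵇ v v refl , fromWitness refl)

_≟ᴸ_ : DecidableEquality Literal
m ≟ᴸ l = map′ ==ᴸ⇒≡ (λ { refl → ==ᴸ-refl m }) (T? (m ==ᴸ l))

open import Data.List.Membership.DecPropositional _≟ᴸ_ using (_∈?_)
open import Data.List.Membership.DecPropositional (≡-dec _≟ᴸ_) using () renaming (_∈?_ to _∈ᶠ?_)

l≢neg-l : ∀ l → l ≢ neg l
l≢neg-l l l≡¬l = not-¬ refl (cong pos l≡¬l)

var≡⇒≡⊎≡neg : ∀ {m l} → var m ≡ var l → m ≡ l ⊎ m ≡ neg l
var≡⇒≡⊎≡neg {lit v true}  {lit .v true}  refl = inj₁ refl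
var≡⇒≡⊎≡neg {lit v true}  {lit .v false} refl = inj₂ refl
var≡⇒≡⊎≡neg {lit v false} {lit .v true}  refl = inj₂ refl
var≡⇒≡⊎≡neg {lit v false} {lit .v false} refl = inj₁ refl

any-==ᴸ⇔∈ : ∀ {l γ} → T (any (_==ᴸ l) γ) ⇔ l ∈ γ
any-==ᴸ⇔∈ {l} {γ} = mk⇔ (Any.map (sym ∘ ==ᴸ⇒≡) ∘ any⁻ _ γ)
                        (any⁺ _ ∘ Any.map (λ { refl → ==ᴸ-refl l }))

-- F ∣ l is, definitionally, map (filterᵇ (survives l)) (filterᵇ (notSatisfiedBy l) F).
notSatisfiedBy : Literal → Clause → Bool
notSatisfiedBy l γ = not (any (_==ᴸ l) γ)

survives : Literal → Literal → Bool
survives l m = not (m ==ᴸ neg l)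

notSatisfiedBy⇔∉ : ∀ {l γ} → T (notSatisfiedBy l γ) ⇔ l ∉ γ
notSatisfiedBy⇔∉ = mk⇔ (λ h l∈γ → Equivalence.to T-not⇔¬T h (Equivalence.from any-==ᴸ⇔∈ l∈γ))
                       (λ l∉γ → Equivalence.from T-not⇔¬T (l∉γ ∘ Equivalence.to any-==ᴸ⇔∈))

survives⇔≢ : ∀ {l m} → T (survives l m) ⇔ m ≢ neg l
survives⇔≢ {l} = mk⇔ (λ { h refl → Equivalence.to T-not⇔¬T h (==ᴸ-refl (neg l)) })
                     (λ m≢¬l → Equivalence.from T-not⇔¬T (m≢¬l ∘ ==ᴸ⇒≡))

occurrence : ∀ {F γ m} → γ ∈ F → m ∈ γ → VarOf (var m) F
occurrence γ∈F m∈γ = _ , γ∈F , _ , m∈γ , refl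

VarOf-there : ∀ {v γ F} → VarOf v F → VarOf v (γ ∷ F)
VarOf-there (δ , δ∈F , occ) = δ , there δ∈F , occ

∣-∷-accept : ∀ {l γ} F → l ∉ γ → (γ ∷ F) ∣ l ≡ filterᵇ (survives l) γ ∷ F ∣ l
∣-∷-accept {l} {γ} F l∉γ = cong (map (filterᵇ (survives l)))
  (filter-accept (T? ∘ notSatisfiedBy l) {γ} {F} (Equivalence.from notSatisfiedBy⇔∉ l∉γ))

∣-∷-reject : ∀ {l γ} F → l ∈ γ → (γ ∷ F) ∣ l ≡ F ∣ l
∣-∷-reject {l} {γ} F l∈γ = cong (map (filterᵇ (survives l)))
  (filter-reject (T? ∘ notSatisfiedBy l) {γ} {F} (λ h → Equivalence.to notSatisfiedBy⇔∉ h l∈γ))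

∈-∣⁻ : ∀ {γ' l} F → γ' ∈ F ∣ l → Σ Clause λ γ → γ ∈ F × l ∉ γ × γ' ≡ filterᵇ (survives l) γ
∈-∣⁻ {l = l} F γ'∈ with ∈-map∘filter⁻ (filterᵇ (survives l)) (T? ∘ notSatisfiedBy l) γ'∈
... | γ , γ∈F , refl , open-γ = γ , γ∈F , Equivalence.to notSatisfiedBy⇔∉ open-γ , refl

∈-∣⁺ : ∀ {γ l} F → γ ∈ F → l ∉ γ → filterᵇ (survives l) γ ∈ F ∣ l
∈-∣⁺ {γ} {l} F γ∈F l∉γ = ∈-map∘filter⁺ (filterᵇ (survives l)) (T? ∘ notSatisfiedBy l)
  (γ , γ∈F , refl , Equivalence.from notSatisfiedBy⇔∉ l∉γ)

∈-survivors⁻ : ∀ {l m γ} → l ∉ γ → m ∈ filterᵇ (survives l) γ → m ∈ γ × var m ≢ var l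
∈-survivors⁻ {l} {m} l∉γ m∈ with ∈-filter⁻ (T? ∘ survives l) m∈
... | m∈γ , kept = m∈γ , var≢
  where
  var≢ : var m ≢ var l
  var≢ eq with var≡⇒≡⊎≡neg {m} {l} eq
  ... | inj₁ refl = l∉γ m∈γ
  ... | inj₂ m≡¬l = Equivalence.to survives⇔≢ kept m≡¬l

VarOf-∣⁻ : ∀ {v l} F → VarOf v (F ∣ l) → VarOf v F × v ≢ var l
VarOf-∣⁻ F (γ' , γ'∈ , m , m∈γ' , refl) with ∈-∣⁻ F γ'∈
... | γ , γ∈F , l∉γ , refl with ∈-survivors⁻ l∉γ m∈γ'
...   | m∈γ , var≢ = occurrence γ∈F m∈γ , var≢

∣-++ : ∀ A B l → (A ++ B) ∣ l ≡ A ∣ l ++ B ∣ l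
∣-++ A B l = trans (cong (map (filterᵇ (survives l))) (filter-++ (T? ∘ notSatisfiedBy l) A B))
                   (map-++ (filterᵇ (survives l)) (filterᵇ (notSatisfiedBy l) A)
                                                  (filterᵇ (notSatisfiedBy l) B))

∣-fresh : ∀ {l} F → ¬ VarOf (var l) F → F ∣ l ≡ F
∣-fresh [] _ = refl
∣-fresh {l} (γ ∷ F) l∉F = begin
  (γ ∷ F) ∣ l                    ≡⟨ ∣-∷-accept F (l∉F ∘ occurrence (here refl)) ⟩
  filterᵇ (survives l) γ ∷ F ∣ l ≡⟨ cong₂ _∷_ (filter-all (T? ∘ survives l) (All.tabulate survive))
                                              (∣-fresh F (l∉F ∘ VarOf-there)) ⟩
  γ ∷ F                          ∎
  where
  open ≡-Reasoning
  survive : ∀ {m} → m ∈ γ → T (survives l m)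
  survive m∈γ = Equivalence.from survives⇔≢ λ m≡¬l →
    l∉F (subst (λ k → VarOf (var k) (γ ∷ F)) m≡¬l (occurrence (here refl) m∈γ))

∨F-∣-self : ∀ l F → (l ∨F F) ∣ l ≡ []
∨F-∣-self l [] = refl
∨F-∣-self l (γ ∷ F) = trans (∣-∷-reject (l ∨F F) (here refl)) (∨F-∣-self l F)

∨F-∣-neg : ∀ l F → (neg l ∨F F) ∣ l ≡ F ∣ l
∨F-∣-neg l [] = refl
∨F-∣-neg l (γ ∷ F) with l ∈? γ
... | yes l∈γ = begin
  (neg l ∨F (γ ∷ F)) ∣ l ≡⟨ ∣-∷-reject {γ = neg l ∷ γ} (neg l ∨F F) (there l∈γ) ⟩
  (neg l ∨F F) ∣ l       ≡⟨ ∨F-∣-neg l F ⟩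
  F ∣ l                  ≡⟨ ∣-∷-reject F l∈γ ⟨
  (γ ∷ F) ∣ l            ∎
  where open ≡-Reasoning
... | no l∉γ = begin
  (neg l ∨F (γ ∷ F)) ∣ l                              ≡⟨ ∣-∷-accept (neg l ∨F F) l∉¬l∷γ ⟩
  filterᵇ (survives l) (neg l ∷ γ) ∷ (neg l ∨F F) ∣ l ≡⟨ cong₂ _∷_ ¬l-deleted (∨F-∣-neg l F) ⟩
  filterᵇ (survives l) γ ∷ F ∣ l                      ≡⟨ ∣-∷-accept F l∉γ ⟨
  (γ ∷ F) ∣ l                                         ∎
  where
  open ≡-Reasoning
  l∉¬l∷γ : l ∉ neg l ∷ γ
  l∉¬l∷γ (here l≡¬l) = l≢neg-l l l≡¬l
  l∉¬l∷γ (there l∈γ) = l∉γ l∈γ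
  ¬l-deleted : filterᵇ (survives l) (neg l ∷ γ) ≡ filterᵇ (survives l) γ
  ¬l-deleted = filter-reject (T? ∘ survives l) {neg l} {γ} (λ h → Equivalence.to (survives⇔≢ {l}) h refl)

∨F-∣-other : ∀ {k l} F → var k ≢ var l → (k ∨F F) ∣ l ≡ k ∨F (F ∣ l)
∨F-∣-other [] _ = refl
∨F-∣-other {k} {l} (γ ∷ F) k≉l with l ∈? γ
... | yes l∈γ = begin
  (k ∨F (γ ∷ F)) ∣ l ≡⟨ ∣-∷-reject {γ = k ∷ γ} (k ∨F F) (there l∈γ) ⟩
  (k ∨F F) ∣ l       ≡⟨ ∨F-∣-other F k≉l ⟩
  k ∨F (F ∣ l)       ≡⟨ cong (k ∨F_) (∣-∷-reject F l∈γ) ⟨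
  k ∨F ((γ ∷ F) ∣ l) ∎
  where open ≡-Reasoning
... | no l∉γ = begin
  (k ∨F (γ ∷ F)) ∣ l                           ≡⟨ ∣-∷-accept (k ∨F F) l∉k∷γ ⟩
  filterᵇ (survives l) (k ∷ γ) ∷ (k ∨F F) ∣ l ≡⟨ cong₂ _∷_ k-kept (∨F-∣-other F k≉l) ⟩
  (k ∷ filterᵇ (survives l) γ) ∷ k ∨F (F ∣ l) ≡⟨ cong (k ∨F_) (∣-∷-accept F l∉γ) ⟨
  k ∨F ((γ ∷ F) ∣ l)                           ∎
  where
  open ≡-Reasoning
  l∉k∷γ : l ∉ k ∷ γ
  l∉k∷γ (here l≡k) = k≉l (cong var (sym l≡k))
  l∉k∷γ (there l∈γ) = l∉γ l∈γ
  k-kept : filterᵇ (survives l) (k ∷ γ) ≡ k ∷ filterᵇ (survives l) γ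
  k-kept = filter-accept (T? ∘ survives l) {k} {γ} (Equivalence.from survives⇔≢ (k≉l ∘ cong var))

assign : Literal → Assignment → Assignment
assign l α v with v ≟ var l
... | yes _ = pos l
... | no _ = α v

evalLit-pos : ∀ α l → α (var l) ≡ pos l → evalLit α l ≡ true
evalLit-pos α (lit v true)  α[v]≡b = α[v]≡b
evalLit-pos α (lit v false) α[v]≡b = cong not α[v]≡b

evalLit-assign-self : ∀ l α → evalLit (assign l α) l ≡ true
evalLit-assign-self l α = evalLit-pos (assign l α) l assigned
  where
  assigned : assign l α (var l) ≡ pos l
  assigned with var l ≟ var l
  ... | yes _ = refl
  ... | no v≢v = contradiction refl v≢v

evalLit-assign-other : ∀ {m} l α → var m ≢ var l → evalLit (assign l α) m ≡ evalLit α m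
evalLit-assign-other {m} l α var≢ = cong (λ b → if pos m then b else not b) unchanged
  where
  unchanged : assign l α (var m) ≡ α (var m)
  unchanged with var m ≟ var l
  ... | yes eq = contradiction eq var≢
  ... | no _ = refl

unsat-∣ : ∀ {F} l → Unsatisfiable F → Unsatisfiable (F ∣ l)
unsat-∣ {F} l unsat (α , α⊨F∣l) = unsat (assign l α , α'⊨F)
  where
  α'⊨F : Satisfies (assign l α) F
  α'⊨F γ γ∈F with l ∈? γ
  ... | yes l∈γ = l , l∈γ , evalLit-assign-self l α
  ... | no l∉γ with α⊨F∣l _ (∈-∣⁺ F γ∈F l∉γ)
  ...   | m , m∈ , m-true with ∈-survivors⁻ l∉γ m∈
  ...     | m∈γ , var≢ = m , m∈γ , trans (evalLit-assign-other l α var≢) m-true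

[]-satisfiable : ¬ Unsatisfiable []
[]-satisfiable unsat = unsat ((λ _ → true) , λ _ ())

unsat-occurrence : ∀ {F} → Unsatisfiable F → [] ∉ F → Σ ℕ λ v → VarOf v F
unsat-occurrence {[]}           unsat _    = ⊥-elim ([]-satisfiable unsat)
unsat-occurrence {[] ∷ F}       _     []∉F = contradiction (here refl) []∉F
unsat-occurrence {(m ∷ γ) ∷ F}  _     _    = var m , occurrence (here refl) (here refl)

any-var? : {P : ℕ → Set} → (∀ v → Dec (P v)) → ∀ F → Dec (Σ ℕ λ v → VarOf v F × P v)
any-var? P? F with Any.any? (Any.any? (P? ∘ var)) F
... | yes found with find found
...   | γ , γ∈F , found-in-γ with find found-in-γ
...     | m , m∈γ , Pm = yes (var m , occurrence γ∈F m∈γ , Pm)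
any-var? P? F | no none =
  no λ { (v , (γ , γ∈F , m , m∈γ , refl) , Pv) → none (lose γ∈F (lose m∈γ Pv)) }

vars : Formula → List ℕ
vars [] = []
vars (γ ∷ F) = map var γ ++ vars F

VarOf⇒∈vars : ∀ {v} F → VarOf v F → v ∈ vars F
VarOf⇒∈vars (γ ∷ F) (_ , here refl , m , m∈γ , refl) = ∈-++⁺ˡ (∈-map⁺ var m∈γ)
VarOf⇒∈vars (γ ∷ F) (δ , there δ∈F , occ) = ∈-++⁺ʳ (map var γ) (VarOf⇒∈vars F (δ , δ∈F , occ))

bst-exists : ∀ vs {F} → (∀ {v} → VarOf v F → v ∈ vs) → Unsatisfiable F → Σ Tree (IsBST F)
bst-exists vs {F} _ _ with [] ∈ᶠ? F
... | yes []∈F = leaf , leaf []∈F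
bst-exists [] cover unsat | no []∉F with cover (proj₂ (unsat-occurrence unsat []∉F))
... | ()
bst-exists (y ∷ vs) {F} cover unsat | no []∉F with any-var? (_≟ y) F
... | yes (_ , y∈F , refl) =
  let T₁ , b₁ = branch false
      T₂ , b₂ = branch true
  in node y T₁ T₂ , node []∉F y∈F b₁ b₂
  where
  branch : ∀ b → Σ Tree (IsBST (F ∣ lit y b))
  branch b = bst-exists vs cover-∣ (unsat-∣ (lit y b) unsat)
    where
    cover-∣ : ∀ {v} → VarOf v (F ∣ lit y b) → v ∈ vs
    cover-∣ v∈ with VarOf-∣⁻ F v∈
    ... | v∈F , v≢y with cover v∈F
    ...   | here v≡y = contradiction v≡y v≢y
    ...   | there v∈vs = v∈vs
... | no y∉F = bst-exists vs cover-tail unsat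
  where
  cover-tail : ∀ {v} → VarOf v F → v ∈ vs
  cover-tail v∈F with cover v∈F
  ... | here refl = contradiction (_ , v∈F , refl) y∉F
  ... | there v∈vs = v∈vs

BST≤ : Formula → ℕ → Set
BST≤ F k = Σ Tree λ T → IsBST F T × size T ≤ k

Branching≤ : Formula → ℕ → ℕ → Set
Branching≤ F k y =
  Σ (Fin (suc k)) λ i → BST≤ (F ∣ lit y false) (toℕ i) × BST≤ (F ∣ lit y true) (k ∸ toℕ i)

branching⇒BST≤ : ∀ {F k y} → [] ∉ F → VarOf y F → Branching≤ F k y → BST≤ F (suc k)
branching⇒BST≤ []∉F y∈F (i , (T₁ , b₁ , s₁) , (T₂ , b₂ , s₂)) =
  node _ T₁ T₂ , node []∉F y∈F b₁ b₂ ,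
  s≤s (≤-trans (+-mono-≤ s₁ s₂) (≤-reflexive (m+[n∸m]≡n (s≤s⁻¹ (toℕ<n i)))))

BST≤⇒branching : ∀ {F k} → [] ∉ F → BST≤ F (suc k) → Σ ℕ λ y → VarOf y F × Branching≤ F k y
BST≤⇒branching []∉F (leaf , leaf []∈F , _) = contradiction []∈F []∉F
BST≤⇒branching {k = k} _ (node y T₁ T₂ , node _ y∈F b₁ b₂ , s≤s s) =
  y , y∈F , fromℕ< |T₁|<1+k ,
  (T₁ , b₁ , ≤-reflexive (sym (toℕ-fromℕ< |T₁|<1+k))) ,
  (T₂ , b₂ , subst (λ j → size T₂ ≤ k ∸ j) (sym (toℕ-fromℕ< |T₁|<1+k))
                   (m+n≤o⇒m≤o∸n (size T₂) (subst (_≤ k) (+-comm (size T₁) (size T₂)) s)))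
  where
  |T₁|<1+k : size T₁ < suc k
  |T₁|<1+k = s≤s (m+n≤o⇒m≤o (size T₁) s)

bst≤? : ∀ k F → Dec (BST≤ F k)
bst≤? = <-rec (λ k → ∀ F → Dec (BST≤ F k)) step
  where
  step : ∀ k → (∀ {j} → j < k → ∀ F → Dec (BST≤ F j)) → ∀ F → Dec (BST≤ F k)
  step k _ F with [] ∈ᶠ? F
  ... | yes []∈F = yes (leaf , leaf []∈F , z≤n)
  step zero _ F | no []∉F = no λ { (leaf , leaf []∈F , _) → []∉F []∈F ; (node _ _ _ , _ , ()) }
  step (suc k) smaller F | no []∉F =
    map′ (λ (y , y∈F , br) → branching⇒BST≤ []∉F y∈F br) (BST≤⇒branching []∉F) (any-var? branching? F)
    where
    branching? : ∀ y → Dec (Branching≤ F k y)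
    branching? y = anyFin? λ i → smaller (toℕ<n i) _ ×-dec smaller (s≤s (m∸n≤m k (toℕ i))) _

module _ {P : ℕ → Set} (P? : ∀ n → Dec (P n)) where

  minimal : ∀ n → P n → Σ ℕ λ m → P m × (∀ j → P j → m ≤ j)
  minimal = <-rec (λ n → P n → Σ ℕ λ m → P m × (∀ j → P j → m ≤ j)) step
    where
    step : ∀ n → (∀ {j} → j < n → P j → Σ ℕ λ m → P m × (∀ j → P j → m ≤ j)) →
           P n → Σ ℕ λ m → P m × (∀ j → P j → m ≤ j)
    step n smaller Pn with anyUpTo? P? n
    ... | yes (j , j<n , Pj) = smaller j<n Pj
    ... | no none = n , Pn , λ j Pj → ≮⇒≥ λ j<n → none (j , j<n , Pj)

optimalBST-exists : ∀ {F} → Unsatisfiable F → Σ Tree (OptimalBST F)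
optimalBST-exists {F} unsat with bst-exists (vars F) (VarOf⇒∈vars F) unsat
... | T₀ , b₀ with minimal (λ k → bst≤? k F) (size T₀) (T₀ , b₀ , ≤-refl)
...   | _ , (T , b , T≤) , least = T , b , λ T' b' → ≤-trans T≤ (least (size T') (T' , b' , ≤-refl))

VarOf-++⁻ : ∀ {v} A B → VarOf v (A ++ B) → VarOf v A ⊎ VarOf v B
VarOf-++⁻ A B (γ , γ∈ , occ) with ∈-++⁻ A γ∈
... | inj₁ γ∈A = inj₁ (γ , γ∈A , occ)
... | inj₂ γ∈B = inj₂ (γ , γ∈B , occ)

VarOf-∨F⁻ : ∀ {v} l F → VarOf v (l ∨F F) → v ≡ var l ⊎ VarOf v F
VarOf-∨F⁻ l F (γ , γ∈ , m , m∈γ , refl) with ∈-map⁻ (l ∷_) γ∈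
... | δ , δ∈F , refl with m∈γ
...   | here refl = inj₁ refl
...   | there m∈δ = inj₂ (occurrence δ∈F m∈δ)

VarOf-+⁻ : ∀ {v} F H x → VarOf v (F +[ x ] H) → v ≡ x ⊎ VarOf v F ⊎ VarOf v H
VarOf-+⁻ F H x v∈ with VarOf-++⁻ (lit x true ∨F F) (lit x false ∨F H) v∈
... | inj₁ v∈x∨F with VarOf-∨F⁻ (lit x true) F v∈x∨F
...   | inj₁ v≡x = inj₁ v≡x
...   | inj₂ v∈F = inj₂ (inj₁ v∈F)
VarOf-+⁻ F H x v∈ | inj₂ v∈¬x∨H with VarOf-∨F⁻ (lit x false) H v∈¬x∨H
...   | inj₁ v≡x = inj₁ v≡x
...   | inj₂ v∈H = inj₂ (inj₂ v∈H)

VarOf-+-x : ∀ {F} H x → Unsatisfiable F → VarOf x (F +[ x ] H)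
VarOf-+-x {[]}    H x unsat = ⊥-elim ([]-satisfiable unsat)
VarOf-+-x {γ ∷ F} H x _     = occurrence (here refl) (here refl)

[]∉∨F : ∀ l F → [] ∉ l ∨F F
[]∉∨F l F []∈ with ∈-map⁻ (l ∷_) []∈
... | _ , _ , ()

[]∉+ : ∀ F H x → [] ∉ F +[ x ] H
[]∉+ F H x []∈ with ∈-++⁻ (lit x true ∨F F) []∈
... | inj₁ []∈x∨F = []∉∨F (lit x true) F []∈x∨F
... | inj₂ []∈¬x∨H = []∉∨F (lit x false) H []∈¬x∨H

+-∣¬x : ∀ {F} H x → ¬ VarOf x F → (F +[ x ] H) ∣ lit x false ≡ F
+-∣¬x {F} H x x∉F = begin
  (F +[ x ] H) ∣ lit x false
    ≡⟨ ∣-++ (lit x true ∨F F) (lit x false ∨F H) (lit x false) ⟩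
  (lit x true ∨F F) ∣ lit x false ++ (lit x false ∨F H) ∣ lit x false
    ≡⟨ cong₂ _++_ (∨F-∣-neg (lit x false) F) (∨F-∣-self (lit x false) H) ⟩
  F ∣ lit x false ++ []
    ≡⟨ ++-identityʳ _ ⟩
  F ∣ lit x false
    ≡⟨ ∣-fresh F x∉F ⟩
  F ∎
  where open ≡-Reasoning

+-∣x : ∀ F {H} x → ¬ VarOf x H → (F +[ x ] H) ∣ lit x true ≡ H
+-∣x F {H} x x∉H = begin
  (F +[ x ] H) ∣ lit x true
    ≡⟨ ∣-++ (lit x true ∨F F) (lit x false ∨F H) (lit x true) ⟩
  (lit x true ∨F F) ∣ lit x true ++ (lit x false ∨F H) ∣ lit x true
    ≡⟨ cong₂ _++_ (∨F-∣-self (lit x true) F) (∨F-∣-neg (lit x true) H) ⟩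
  H ∣ lit x true
    ≡⟨ ∣-fresh H x∉H ⟩
  H ∎
  where open ≡-Reasoning

+-∣ : ∀ F H {x l} → x ≢ var l → (F +[ x ] H) ∣ l ≡ (F ∣ l) +[ x ] (H ∣ l)
+-∣ F H {x} {l} x≢l = begin
  (F +[ x ] H) ∣ l                                ≡⟨ ∣-++ (lit x true ∨F F) (lit x false ∨F H) l ⟩
  (lit x true ∨F F) ∣ l ++ (lit x false ∨F H) ∣ l ≡⟨ cong₂ _++_ (∨F-∣-other F x≢l) (∨F-∣-other H x≢l) ⟩
  (F ∣ l) +[ x ] (H ∣ l)                          ∎
  where open ≡-Reasoning

+-∣ˡ : ∀ F H {x l} → x ≢ var l → ¬ VarOf (var l) H → (F +[ x ] H) ∣ l ≡ (F ∣ l) +[ x ] H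
+-∣ˡ F H {x} x≢l l∉H = trans (+-∣ F H x≢l) (cong ((F ∣ _) +[ x ]_) (∣-fresh H l∉H))

+-∣ʳ : ∀ F H {x l} → x ≢ var l → ¬ VarOf (var l) F → (F +[ x ] H) ∣ l ≡ F +[ x ] (H ∣ l)
+-∣ʳ F H {x} x≢l l∉F = trans (+-∣ F H x≢l) (cong (_+[ x ] (H ∣ _)) (∣-fresh F l∉F))

record Separated (x : ℕ) (F H : Formula) : Set where
  field
    disjoint : ∀ v → VarOf v F → ¬ VarOf v H
    x∉F      : ¬ VarOf x F
    x∉H      : ¬ VarOf x H

Separated-∣ˡ : ∀ {x F H} l → Separated x F H → Separated x (F ∣ l) H
Separated-∣ˡ {F = F} l sep = record
  { disjoint = λ v → disjoint v ∘ proj₁ ∘ VarOf-∣⁻ F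
  ; x∉F      = x∉F ∘ proj₁ ∘ VarOf-∣⁻ F
  ; x∉H      = x∉H
  }
  where open Separated sep

Separated-∣ʳ : ∀ {x F H} l → Separated x F H → Separated x F (H ∣ l)
Separated-∣ʳ {H = H} l sep = record
  { disjoint = λ v v∈F → disjoint v v∈F ∘ proj₁ ∘ VarOf-∣⁻ H
  ; x∉F      = x∉F
  ; x∉H      = x∉H ∘ proj₁ ∘ VarOf-∣⁻ H
  }
  where open Separated sep

BST≤-branch : ∀ {F y A₁ A₂} → VarOf y F → IsBST (F ∣ lit y false) A₁ → IsBST (F ∣ lit y true) A₂ →
              BST≤ F (size (node y A₁ A₂))
BST≤-branch {F} y∈F a₁ a₂ with [] ∈ᶠ? F
... | yes []∈F = leaf , leaf []∈F , z≤n
... | no []∉F = node _ _ _ , node []∉F y∈F a₁ a₂ , ≤-refl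

Splits : Formula → Formula → Tree → Set
Splits F H T = Σ Tree λ A → Σ Tree λ B → IsBST F A × IsBST H B × size A + size B < size T

split-boundˡ : ∀ {a b c d t u} → c ≤ suc (a + d) → a + b < t → d ≤ u → c + b ≤ t + u
split-boundˡ {a} {b} {c} {d} {t} {u} c≤ a+b<t d≤u = begin
  c + b           ≤⟨ +-monoˡ-≤ b c≤ ⟩
  suc (a + d + b) ≡⟨ cong suc (xy∙z≈xz∙y a d b) ⟩
  suc (a + b) + d ≤⟨ +-mono-≤ a+b<t d≤u ⟩
  t + u           ∎
  where open ≤-Reasoning

split-boundʳ : ∀ {a b c d t u} → c ≤ suc (b + d) → a + b < t → d ≤ u → a + c ≤ t + u
split-boundʳ {a} {b} {c} {d} {t} {u} c≤ a+b<t d≤u =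
  subst (_≤ t + u) (+-comm c a) (split-boundˡ c≤ (subst (_< t) (+-comm a b) a+b<t) d≤u)

splits-node-F : ∀ {F H y T₁ T₂} → VarOf y F →
                Splits (F ∣ lit y false) H T₁ → Splits (F ∣ lit y true) H T₂ → Splits F H (node y T₁ T₂)
splits-node-F y∈F (A₁ , B₁ , a₁ , h₁ , s₁) (A₂ , _ , a₂ , _ , s₂) with BST≤-branch y∈F a₁ a₂
... | A , a , A≤ = A , B₁ , a , h₁ , s≤s (split-boundˡ A≤ s₁ (m+n≤o⇒m≤o (size A₂) (<⇒≤ s₂)))

splits-node-H : ∀ {F H y T₁ T₂} → VarOf y H →
                Splits F (H ∣ lit y false) T₁ → Splits F (H ∣ lit y true) T₂ → Splits F H (node y T₁ T₂)
splits-node-H y∈H (A₁ , B₁ , a₁ , h₁ , s₁) (A₂ , _ , _ , h₂ , s₂) with BST≤-branch y∈H h₁ h₂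
... | B , h , B≤ = A₁ , B , a₁ , h , s≤s (split-boundʳ B≤ s₁ (m+n≤o⇒n≤o (size A₂) (<⇒≤ s₂)))

lower-bound : ∀ {x F H} T → Separated x F H → IsBST (F +[ x ] H) T → Splits F H T
lower-bound {x} {F} {H} leaf _ (leaf []∈) = ⊥-elim ([]∉+ F H x []∈)
lower-bound {x} {F} {H} (node y T₁ T₂) sep (node _ y∈ b₁ b₂) with y ≟ x | VarOf-+⁻ F H x y∈
... | yes refl | _ = T₁ , T₂ , subst (λ G → IsBST G T₁) (+-∣¬x H x (Separated.x∉F sep)) b₁
                            , subst (λ G → IsBST G T₂) (+-∣x F x (Separated.x∉H sep)) b₂ , n<1+n _
... | no y≢x | inj₁ y≡x = contradiction y≡x y≢x
... | no y≢x | inj₂ (inj₁ y∈F) =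
  splits-node-F y∈F (lower-bound T₁ (Separated-∣ˡ _ sep) (restrictˡ b₁))
                    (lower-bound T₂ (Separated-∣ˡ _ sep) (restrictˡ b₂))
  where
  restrictˡ : ∀ {b T} → IsBST ((F +[ x ] H) ∣ lit y b) T → IsBST ((F ∣ lit y b) +[ x ] H) T
  restrictˡ {T = T} = subst (λ G → IsBST G T) (+-∣ˡ F H (y≢x ∘ sym) (Separated.disjoint sep y y∈F))
... | no y≢x | inj₂ (inj₂ y∈H) =
  splits-node-H y∈H (lower-bound T₁ (Separated-∣ʳ _ sep) (restrictʳ b₁))
                    (lower-bound T₂ (Separated-∣ʳ _ sep) (restrictʳ b₂))
  where
  restrictʳ : ∀ {b T} → IsBST ((F +[ x ] H) ∣ lit y b) T → IsBST (F +[ x ] (H ∣ lit y b)) T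
  restrictʳ {T = T} =
    subst (λ G → IsBST G T) (+-∣ʳ F H (y≢x ∘ sym) (λ y∈F → Separated.disjoint sep y y∈F y∈H))

lemma4 : (F H : Formula) (x : ℕ) →
           (∀ v → VarOf v F → ¬ VarOf v H) →
           ¬ VarOf x F → ¬ VarOf x H →
           Unsatisfiable F → Unsatisfiable H →
           Σ Tree λ T₁ → Σ Tree λ T₂ → OptimalBST (F +[ x ] H) (node x T₁ T₂)
lemma4 F H x disjoint x∉F x∉H unsatF unsatH with optimalBST-exists unsatF | optimalBST-exists unsatH
... | TF , bF , optF | TH , bH , optH = TF , TH , rooted , optimal
  where
  rooted : IsBST (F +[ x ] H) (node x TF TH)
  rooted = node ([]∉+ F H x) (VarOf-+-x H x unsatF)
                (subst (λ G → IsBST G TF) (sym (+-∣¬x H x x∉F)) bF)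
                (subst (λ G → IsBST G TH) (sym (+-∣x F x x∉H)) bH)
  optimal : ∀ T → IsBST (F +[ x ] H) T → size (node x TF TH) ≤ size T
  optimal T b with lower-bound T (record { disjoint = disjoint ; x∉F = x∉F ; x∉H = x∉H }) b
  ... | A , B , a , h , A+B<T = ≤-trans (s≤s (+-mono-≤ (optF A a) (optH B h))) A+B<T
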